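{- Let $C:\{0,1\}^n\to\{0,1\}^m$ be a Boolean circuit with $m>n$, let $\varepsilon>0$, and let $M$ be a probabilistic oracle Turing machine with oracle $\mathsf{MCSP}$ that takes input $(1/\varepsilon, C, y)$ and randomness $\tau$. For $y\in\{0,1\}^m$ let $I_{C,y,\tau}$ be the event that $C\big(M^{\mathsf{MCSP}}(1/\varepsilon, C, y, \tau)\big) = y$, and $\bar I_{C,y,\tau}$ its complement. Then $$\Pr_{y\in\{0,1\}^m,\ \tau}\left[y\notin \mathrm{Im}(C) \;\middle|\; \bar I_{C,y,\tau}\right] \ge \Pr_{x\in\{0,1\}^n,\ \tau}\left[I_{C,C(x),\tau}\right],$$ where $y$ and $x$ are chosen uniformly at random.
   Context: $\mathrm{Im}(C)$ is the image of $C$. $\mathsf{MCSP}$ is the Minimum Circuit Size Problem: given the truth table of a Boolean function and a size parameter $s$, decide whether the function has a circuit of size at most $s$. -}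

module Defs where

open import Data.Bool using (Bool; true; false; _∧_; not)
import Data.Bool as B
open import Data.Nat using (ℕ; zero; suc)
open import Data.Integer using (+_)
open import Data.Rational using (ℚ; _/_; 0ℚ)
open import Data.List using (List; []; _∷_; [_]; map; _++_; length; filter; cartesianProduct)
open import Data.Bool.ListAction using (any)
open import Data.Vec using (Vec; []; _∷_)
open import Data.Vec.Properties using (≡-dec)
open import Data.Maybe using (Maybe; just; nothing)
open import Data.Product using (_×_; _,_; proj₁; proj₂)
open import Relation.Nullary.Decidable using (⌊_⌋)
open import Relation.Unary using (Decidable)

Bits : ℕ → Set
Bits n = Vec Bool n

allBits : (n : ℕ) → List (Bits n)
allBits zero = [ [] ]
allBits (suc n) = map (false ∷_) (allBits n) ++ map (true ∷_) (allBits n)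

eqBits : {n : ℕ} → Bits n → Bits n → Bool
eqBits x y = ⌊ ≡-dec B._≟_ x y ⌋

count : {X : Set} → (X → Bool) → List X → ℕ
count P xs = length (filter (λ x → B.T? (P x)) xs)

-- ratio a / b as a rational number (0 if b = 0)
ratio : ℕ → ℕ → ℚ
ratio a zero = 0ℚ
ratio a (suc b) = (+ a) / suc b

-- Pr_{x uniform from the (finite, repetition-free) sample space xs}[ A x ]
Pr : {X : Set} → List X → (X → Bool) → ℚ
Pr xs A = ratio (count A xs) (length xs)

PrCond : {X : Set} → List X → (X → Bool) → (X → Bool) → ℚ
PrCond xs A E = ratio (count (λ x → A x ∧ E x) xs) (count E xs)

inImage : {n m : ℕ} → (Bits n → Bits m) → Bits m → Bool
inImage {n} C y = any (λ x → eqBits (C x) y) (allBits n)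

-- the event I_{C,y,τ}: the machine outputs some x ∈ {0,1}^n with C(x) = y
-- (an output that is not an n-bit string counts as failure)
succeeds : {n m : ℕ} → (Bits n → Bits m) → Maybe (Bits n) → Bits m → Bool
succeeds C nothing y = false
succeeds C (just x) y = eqBits (C x) y

{-# OPTIONS --safe #-}
module Submission where

-- Count pairs (x, τ) on which the inverter succeeds (S) or fails (G) on C x, and pairs (y, τ)
-- with y ∉ Im C (A) or y ∈ Im C (F) on which it fails. The two probabilities are S/(S+G) and
-- A/(A+F), and t/(t+u) grows with t and falls with u. Every image point has a preimage, so
-- F ≤ G. An inverter can only succeed inside the image, so it fails at every y ∉ Im C, whence
-- A = |{0,1}^m ∖ Im C|·|τ| ≥ (2^m − 2^n)·|τ| ≥ 2^n·|τ| ≥ S as m > n. Nothing depends on ε or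
-- on the oracle: the bound holds for every function M.

module InversionBound where

  open import Algebra.Properties.CommutativeSemigroup using (interchange)
  open import Data.Bool using (Bool; true; false; not; _∧_; T?)
  open import Data.Bool.ListAction using (any)
  open import Data.Bool.Properties using (T-≡; ∧-identityʳ)
  open import Data.Integer using (+≤+)
  import Data.Integer as ℤ
  open import Data.Integer.Properties using (pos-*)
  open import Data.List using (List; []; _∷_; map; _++_; length; cartesianProduct)
  open import Data.List.Membership.Propositional using (_∈_; lose)
  open import Data.List.Membership.Propositional.Properties using (∈-map⁺; ∈-++⁺ˡ; ∈-++⁺ʳ)
  open import Data.List.Properties using (length-++; length-map; length-filter)
  open import Data.List.Relation.Unary.Any using (here)
  open import Data.List.Relation.Unary.Any.Properties using (any⁺)
  open import Data.Maybe using (Maybe; just)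
  open import Data.Nat
  open import Data.Nat.Properties
  open import Data.Product using (_×_; _,_; proj₁)
  open import Data.Rational using (0ℚ) renaming (_≤_ to _≤ℚ_)
  import Data.Rational.Properties as ℚ
  open import Data.Rational.Unnormalised using (mkℚᵘ; *≤*)
  import Data.Rational.Unnormalised.Properties as ℚᵘ
  open import Data.Vec using ([]; _∷_)
  open import Data.Vec.Properties using (≡-dec)
  open import Function using (_∘_; Equivalence)
  open import Relation.Binary.PropositionalEquality
  open import Relation.Nullary using (yes; no)
  open import Defs

  open Equivalence using (to; from)

  variable
    X Y : Set

  ⟦_⟧ : Bool → ℕ
  ⟦ true ⟧ = 1
  ⟦ false ⟧ = 0

  ∑ : List X → (X → ℕ) → ℕ
  ∑ [] f = 0
  ∑ (x ∷ xs) f = f x + ∑ xs f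

  ∑-cong : (xs : List X) {f g : X → ℕ} → (∀ x → f x ≡ g x) → ∑ xs f ≡ ∑ xs g
  ∑-cong [] f≗g = refl
  ∑-cong (x ∷ xs) f≗g = cong₂ _+_ (f≗g x) (∑-cong xs f≗g)

  ∑-mono-≤ : (xs : List X) {f g : X → ℕ} → (∀ x → f x ≤ g x) → ∑ xs f ≤ ∑ xs g
  ∑-mono-≤ [] f≤g = z≤n
  ∑-mono-≤ (x ∷ xs) f≤g = +-mono-≤ (f≤g x) (∑-mono-≤ xs f≤g)

  ∑-zero : (xs : List X) → ∑ xs (λ _ → 0) ≡ 0
  ∑-zero [] = refl
  ∑-zero (x ∷ xs) = ∑-zero xs

  ∑-const : (xs : List X) (c : ℕ) → ∑ xs (λ _ → c) ≡ length xs * c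
  ∑-const [] c = refl
  ∑-const (x ∷ xs) c = cong (c +_) (∑-const xs c)

  ∑-++ : (xs ys : List X) (f : X → ℕ) → ∑ (xs ++ ys) f ≡ ∑ xs f + ∑ ys f
  ∑-++ [] ys f = refl
  ∑-++ (x ∷ xs) ys f = trans (cong (f x +_) (∑-++ xs ys f)) (sym (+-assoc (f x) _ _))

  ∑-map : (g : X → Y) (xs : List X) (f : Y → ℕ) → ∑ (map g xs) f ≡ ∑ xs (f ∘ g)
  ∑-map g [] f = refl
  ∑-map g (x ∷ xs) f = cong (f (g x) +_) (∑-map g xs f)

  ∑-+ : (xs : List X) (f g : X → ℕ) → ∑ xs (λ x → f x + g x) ≡ ∑ xs f + ∑ xs g
  ∑-+ [] f g = refl
  ∑-+ (x ∷ xs) f g = trans (cong (f x + g x +_) (∑-+ xs f g))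
                           (interchange +-commutativeSemigroup (f x) (g x) _ _)

  ∑-*ʳ : (xs : List X) (f : X → ℕ) (c : ℕ) → ∑ xs (λ x → f x * c) ≡ ∑ xs f * c
  ∑-*ʳ [] f c = refl
  ∑-*ʳ (x ∷ xs) f c = trans (cong (f x * c +_) (∑-*ʳ xs f c)) (sym (*-distribʳ-+ c (f x) _))

  ∑-swap : (xs : List X) (ys : List Y) (f : X → Y → ℕ) →
           ∑ xs (λ x → ∑ ys (f x)) ≡ ∑ ys (λ y → ∑ xs (λ x → f x y))
  ∑-swap [] ys f = sym (∑-zero ys)
  ∑-swap (x ∷ xs) ys f = trans (cong (∑ ys (f x) +_) (∑-swap xs ys f)) (sym (∑-+ ys (f x) _))

  ∑-cartesianProduct : (xs : List X) (ys : List Y) (f : X × Y → ℕ) →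
                       ∑ (cartesianProduct xs ys) f ≡ ∑ xs (λ x → ∑ ys (λ y → f (x , y)))
  ∑-cartesianProduct [] ys f = refl
  ∑-cartesianProduct (x ∷ xs) ys f =
    trans (∑-++ (map (x ,_) ys) _ f) (cong₂ _+_ (∑-map (x ,_) ys f) (∑-cartesianProduct xs ys f))

  ⟦any⟧≤∑ : (p : X → Bool) (xs : List X) → ⟦ any p xs ⟧ ≤ ∑ xs (⟦_⟧ ∘ p)
  ⟦any⟧≤∑ p [] = z≤n
  ⟦any⟧≤∑ p (x ∷ xs) with p x
  ... | true = s≤s z≤n
  ... | false = ⟦any⟧≤∑ p xs

  count≡∑ : (P : X → Bool) (xs : List X) → count P xs ≡ ∑ xs (⟦_⟧ ∘ P)
  count≡∑ P [] = refl
  count≡∑ P (x ∷ xs) with P x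
  ... | true = cong suc (count≡∑ P xs)
  ... | false = count≡∑ P xs

  count≤length : (P : X → Bool) (xs : List X) → count P xs ≤ length xs
  count≤length P = length-filter (λ x → T? (P x))

  count-cong : (xs : List X) {P Q : X → Bool} → (∀ x → P x ≡ Q x) → count P xs ≡ count Q xs
  count-cong xs P≗Q = trans (count≡∑ _ xs) (trans (∑-cong xs (cong ⟦_⟧ ∘ P≗Q)) (sym (count≡∑ _ xs)))

  count-const : (b : Bool) (xs : List X) → count (λ _ → b) xs ≡ ⟦ b ⟧ * length xs
  count-const b xs = trans (count≡∑ _ xs) (trans (∑-const xs ⟦ b ⟧) (*-comm (length xs) _))

  count-∧ˡ : (b : Bool) (P : X → Bool) (xs : List X) → count (λ x → b ∧ P x) xs ≡ ⟦ b ⟧ * count P xs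
  count-∧ˡ true P xs = sym (+-identityʳ _)
  count-∧ˡ false P xs = count-const false xs

  count+count-not : (P : X → Bool) (xs : List X) → count P xs + count (not ∘ P) xs ≡ length xs
  count+count-not P [] = refl
  count+count-not P (x ∷ xs) with P x
  ... | true = cong suc (count+count-not P xs)
  ... | false = trans (+-suc _ _) (cong suc (count+count-not P xs))

  count-split : (P Q : X → Bool) (xs : List X) →
                count (λ x → not (P x) ∧ Q x) xs + count (λ x → P x ∧ Q x) xs ≡ count Q xs
  count-split P Q [] = refl
  count-split P Q (x ∷ xs) with P x | Q x
  ... | true | true = trans (+-suc _ _) (cong suc (count-split P Q xs))
  ... | false | true = cong suc (count-split P Q xs)
  ... | true | false = count-split P Q xs
  ... | false | false = count-split P Q xs

  length-cartesianProduct : (xs : List X) (ys : List Y) →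
                            length (cartesianProduct xs ys) ≡ length xs * length ys
  length-cartesianProduct [] ys = refl
  length-cartesianProduct (x ∷ xs) ys =
    trans (length-++ (map (x ,_) ys)) (cong₂ _+_ (length-map (x ,_) ys) (length-cartesianProduct xs ys))

  count-cartesianProduct : (P : X × Y → Bool) (xs : List X) (ys : List Y) →
    count P (cartesianProduct xs ys) ≡ ∑ xs (λ x → count (λ y → P (x , y)) ys)
  count-cartesianProduct P xs ys =
    trans (count≡∑ P (cartesianProduct xs ys))
          (trans (∑-cartesianProduct xs ys (⟦_⟧ ∘ P)) (∑-cong xs (λ x → sym (count≡∑ _ ys))))

  count-proj₁ : (P : X → Bool) (xs : List X) (ys : List Y) →
                count (P ∘ proj₁) (cartesianProduct xs ys) ≡ count P xs * length ys
  count-proj₁ P xs ys = begin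
    count (P ∘ proj₁) (cartesianProduct xs ys)  ≡⟨ count-cartesianProduct (P ∘ proj₁) xs ys ⟩
    ∑ xs (λ x → count (λ _ → P x) ys)            ≡⟨ ∑-cong xs (λ x → count-const (P x) ys) ⟩
    ∑ xs (λ x → ⟦ P x ⟧ * length ys)            ≡⟨ ∑-*ʳ xs (⟦_⟧ ∘ P) (length ys) ⟩
    ∑ xs (⟦_⟧ ∘ P) * length ys                   ≡⟨ cong (_* length ys) (count≡∑ P xs) ⟨
    count P xs * length ys                       ∎
    where open ≡-Reasoning

  length-allBits : (k : ℕ) → length (allBits k) ≡ 2 ^ k
  length-allBits zero = refl
  length-allBits (suc k) = begin
    length (map (false ∷_) (allBits k) ++ map (true ∷_) (allBits k))
      ≡⟨ length-++ (map (false ∷_) (allBits k)) ⟩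
    length (map (false ∷_) (allBits k)) + length (map (true ∷_) (allBits k))
      ≡⟨ cong₂ _+_ (length-map (false ∷_) (allBits k)) (length-map (true ∷_) (allBits k)) ⟩
    length (allBits k) + length (allBits k)
      ≡⟨ cong (λ l → l + l) (length-allBits k) ⟩
    2 ^ k + 2 ^ k
      ≡⟨ cong (2 ^ k +_) (+-identityʳ (2 ^ k)) ⟨
    2 ^ suc k
      ∎
    where open ≡-Reasoning

  ∈-allBits : {k : ℕ} (x : Bits k) → x ∈ allBits k
  ∈-allBits [] = here refl
  ∈-allBits (false ∷ x) = ∈-++⁺ˡ (∈-map⁺ (false ∷_) (∈-allBits x))
  ∈-allBits (true ∷ x) = ∈-++⁺ʳ (map (false ∷_) _) (∈-map⁺ (true ∷_) (∈-allBits x))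

  eqBits-∷ : {k : ℕ} (b : Bool) (x y : Bits k) → eqBits (b ∷ x) (b ∷ y) ≡ eqBits x y
  eqBits-∷ b x y with ≡-dec Data.Bool._≟_ x y | b
  ... | yes _ | false = refl
  ... | yes _ | true = refl
  ... | no _ | false = refl
  ... | no _ | true = refl

  ∑-allBits-suc : {k : ℕ} (f : Bits (suc k) → ℕ) →
    ∑ (allBits (suc k)) f ≡ ∑ (allBits k) (f ∘ (false ∷_)) + ∑ (allBits k) (f ∘ (true ∷_))
  ∑-allBits-suc {k} f = trans (∑-++ (map (false ∷_) (allBits k)) _ f)
                              (cong₂ _+_ (∑-map (false ∷_) (allBits k) f) (∑-map (true ∷_) (allBits k) f))

  -- The half of allBits (suc k) whose head differs from that of c contributes ∑ 0, since eqBits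
  -- of vectors with different heads computes to false.
  ∑-allBits-δ : {k : ℕ} (c : Bits k) (h : Bits k → ℕ) → ∑ (allBits k) (λ y → ⟦ eqBits c y ⟧ * h y) ≡ h c
  ∑-allBits-δ [] h = trans (+-identityʳ _) (+-identityʳ (h []))
  ∑-allBits-δ {suc k} (false ∷ c) h = begin
    ∑ (allBits (suc k)) (λ y → ⟦ eqBits (false ∷ c) y ⟧ * h y)
      ≡⟨ ∑-allBits-suc (λ y → ⟦ eqBits (false ∷ c) y ⟧ * h y) ⟩
    ∑ (allBits k) (λ y → ⟦ eqBits (false ∷ c) (false ∷ y) ⟧ * h (false ∷ y)) + ∑ (allBits k) (λ _ → 0)
      ≡⟨ cong₂ _+_ (∑-cong (allBits k) (λ y → cong (λ e → ⟦ e ⟧ * h (false ∷ y)) (eqBits-∷ false c y)))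
                   (∑-zero (allBits k)) ⟩
    ∑ (allBits k) (λ y → ⟦ eqBits c y ⟧ * h (false ∷ y)) + 0
      ≡⟨ +-identityʳ _ ⟩
    ∑ (allBits k) (λ y → ⟦ eqBits c y ⟧ * h (false ∷ y))
      ≡⟨ ∑-allBits-δ c (h ∘ (false ∷_)) ⟩
    h (false ∷ c)
      ∎
    where open ≡-Reasoning
  ∑-allBits-δ {suc k} (true ∷ c) h = begin
    ∑ (allBits (suc k)) (λ y → ⟦ eqBits (true ∷ c) y ⟧ * h y)
      ≡⟨ ∑-allBits-suc (λ y → ⟦ eqBits (true ∷ c) y ⟧ * h y) ⟩
    ∑ (allBits k) (λ _ → 0) + ∑ (allBits k) (λ y → ⟦ eqBits (true ∷ c) (true ∷ y) ⟧ * h (true ∷ y))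
      ≡⟨ cong₂ _+_ (∑-zero (allBits k))
                   (∑-cong (allBits k) (λ y → cong (λ e → ⟦ e ⟧ * h (true ∷ y)) (eqBits-∷ true c y))) ⟩
    ∑ (allBits k) (λ y → ⟦ eqBits c y ⟧ * h (true ∷ y))
      ≡⟨ ∑-allBits-δ c (h ∘ (true ∷_)) ⟩
    h (true ∷ c)
      ∎
    where open ≡-Reasoning

  succeeds⇒inImage : {n m : ℕ} (C : Bits n → Bits m) (o : Maybe (Bits n)) {y : Bits m} →
                     succeeds C o y ≡ true → inImage C y ≡ true
  succeeds⇒inImage C (just x) Cx≡y = to T-≡ (any⁺ _ (lose (∈-allBits x) (from T-≡ Cx≡y)))

  ∑-inImage-≤ : {n m : ℕ} (C : Bits n → Bits m) (w : Bits m → ℕ) →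
                ∑ (allBits m) (λ y → ⟦ inImage C y ⟧ * w y) ≤ ∑ (allBits n) (w ∘ C)
  ∑-inImage-≤ {n} {m} C w = begin
    ∑ (allBits m) (λ y → ⟦ inImage C y ⟧ * w y)
      ≤⟨ ∑-mono-≤ (allBits m) (λ y → *-monoˡ-≤ (w y) (⟦any⟧≤∑ (λ x → eqBits (C x) y) (allBits n))) ⟩
    ∑ (allBits m) (λ y → ∑ (allBits n) (λ x → ⟦ eqBits (C x) y ⟧) * w y)
      ≡⟨ ∑-cong (allBits m) (λ y → ∑-*ʳ (allBits n) (λ x → ⟦ eqBits (C x) y ⟧) (w y)) ⟨
    ∑ (allBits m) (λ y → ∑ (allBits n) (λ x → ⟦ eqBits (C x) y ⟧ * w y))
      ≡⟨ ∑-swap (allBits n) (allBits m) (λ x y → ⟦ eqBits (C x) y ⟧ * w y) ⟨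
    ∑ (allBits n) (λ x → ∑ (allBits m) (λ y → ⟦ eqBits (C x) y ⟧ * w y))
      ≡⟨ ∑-cong (allBits n) (λ x → ∑-allBits-δ (C x) w) ⟩
    ∑ (allBits n) (w ∘ C)
      ∎
    where open ≤-Reasoning

  count-inImage-≤ : {n m : ℕ} (C : Bits n → Bits m) → count (inImage C) (allBits m) ≤ 2 ^ n
  count-inImage-≤ {n} {m} C = begin
    count (inImage C) (allBits m)                ≡⟨ count≡∑ (inImage C) (allBits m) ⟩
    ∑ (allBits m) (⟦_⟧ ∘ inImage C)              ≡⟨ ∑-cong (allBits m) (λ y → *-identityʳ _) ⟨
    ∑ (allBits m) (λ y → ⟦ inImage C y ⟧ * 1)    ≤⟨ ∑-inImage-≤ C (λ _ → 1) ⟩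
    ∑ (allBits n) (λ _ → 1)                      ≡⟨ ∑-const (allBits n) 1 ⟩
    length (allBits n) * 1                       ≡⟨ *-identityʳ _ ⟩
    length (allBits n)                           ≡⟨ length-allBits n ⟩
    2 ^ n                                        ∎
    where open ≤-Reasoning

  2^n≤count-notInImage : {n m : ℕ} (C : Bits n → Bits m) → n < m →
                         2 ^ n ≤ count (not ∘ inImage C) (allBits m)
  2^n≤count-notInImage {n} {m} C n<m = +-cancelˡ-≤ (2 ^ n) _ _ (begin
    2 ^ n + 2 ^ n                                                  ≡⟨ cong (2 ^ n +_) (+-identityʳ (2 ^ n)) ⟨
    2 ^ suc n                                                      ≤⟨ ^-monoʳ-≤ 2 n<m ⟩
    2 ^ m                                                          ≡⟨ length-allBits m ⟨
    length (allBits m)                                             ≡⟨ count+count-not (inImage C) (allBits m) ⟨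
    count (inImage C) (allBits m) + count (not ∘ inImage C) (allBits m)  ≤⟨ +-monoˡ-≤ _ (count-inImage-≤ C) ⟩
    2 ^ n + count (not ∘ inImage C) (allBits m)                    ∎)
    where open ≤-Reasoning

  count-inImage-∧-≤ : {n m : ℕ} (C : Bits n → Bits m) (Q : Bits m → X → Bool) (rs : List X) →
    count (λ (y , τ) → inImage C y ∧ Q y τ) (cartesianProduct (allBits m) rs)
      ≤ count (λ (x , τ) → Q (C x) τ) (cartesianProduct (allBits n) rs)
  count-inImage-∧-≤ {n = n} {m = m} C Q rs = begin
    count (λ (y , τ) → inImage C y ∧ Q y τ) (cartesianProduct (allBits m) rs)
      ≡⟨ count-cartesianProduct (λ (y , τ) → inImage C y ∧ Q y τ) (allBits m) rs ⟩
    ∑ (allBits m) (λ y → count (λ τ → inImage C y ∧ Q y τ) rs)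
      ≡⟨ ∑-cong (allBits m) (λ y → count-∧ˡ (inImage C y) (Q y) rs) ⟩
    ∑ (allBits m) (λ y → ⟦ inImage C y ⟧ * count (Q y) rs)
      ≤⟨ ∑-inImage-≤ C (λ y → count (Q y) rs) ⟩
    ∑ (allBits n) (λ x → count (Q (C x)) rs)
      ≡⟨ count-cartesianProduct (λ (x , τ) → Q (C x) τ) (allBits n) rs ⟨
    count (λ (x , τ) → Q (C x) τ) (cartesianProduct (allBits n) rs)
      ∎
    where open ≤-Reasoning

  -- ratio a (suc b) is fromℚᵘ (mkℚᵘ (+ a) b) by definition, and 0ℚ is ratio 0 1.
  ratio-≤-cross : (a b c d : ℕ) → a * suc d ≤ c * suc b → ratio a (suc b) ≤ℚ ratio c (suc d)
  ratio-≤-cross a b c d ad≤cb = ℚ.toℚᵘ-cancel-≤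
    (ℚᵘ.≤-respˡ-≃ (ℚᵘ.≃-sym (ℚ.toℚᵘ-fromℚᵘ (mkℚᵘ (ℤ.+ a) b)))
    (ℚᵘ.≤-respʳ-≃ (ℚᵘ.≃-sym (ℚ.toℚᵘ-fromℚᵘ (mkℚᵘ (ℤ.+ c) d)))
    (*≤* (subst₂ ℤ._≤_ (pos-* a (suc d)) (pos-* c (suc b)) (+≤+ ad≤cb)))))

  0≤ratio : (a b : ℕ) → 0ℚ ≤ℚ ratio a b
  0≤ratio a zero = ℚ.≤-refl
  0≤ratio a (suc b) = ratio-≤-cross 0 0 a b z≤n

  ratio[s,s+g]≤ratio[a,a+f] : {s g a f : ℕ} → s ≤ a → f ≤ g → ratio s (s + g) ≤ℚ ratio a (a + f)
  ratio[s,s+g]≤ratio[a,a+f] {s} {g} {a} {f} s≤a f≤g with s + g in s+g≡ | a + f in a+f≡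
  ... | zero | a+f = 0≤ratio a a+f
  ... | suc t | zero = ratio-≤-cross s t 0 0 (begin
    s * 1   ≡⟨ *-identityʳ s ⟩
    s       ≤⟨ s≤a ⟩
    a       ≤⟨ m≤m+n a f ⟩
    a + f   ≡⟨ a+f≡ ⟩
    0       ∎)
    where open ≤-Reasoning
  ... | suc t | suc d = ratio-≤-cross s t a d (begin
    s * suc d      ≡⟨ cong (s *_) a+f≡ ⟨
    s * (a + f)    ≡⟨ *-distribˡ-+ s a f ⟩
    s * a + s * f  ≤⟨ +-monoʳ-≤ (s * a) (*-mono-≤ s≤a f≤g) ⟩
    s * a + a * g  ≡⟨ cong (_+ a * g) (*-comm s a) ⟩
    a * s + a * g  ≡⟨ *-distribˡ-+ a s g ⟨
    a * (s + g)    ≡⟨ cong (a *_) s+g≡ ⟩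
    a * suc t      ∎)
    where open ≤-Reasoning

  Pr[inverts]≤Pr[∉Im∣fails] : {R : Set} {n m : ℕ} → n < m → (C : Bits n → Bits m)
    (solves : Bits m → R → Bool) → (∀ {y τ} → solves y τ ≡ true → inImage C y ≡ true) →
    (rs : List R) →
    Pr (cartesianProduct (allBits n) rs) (λ (x , τ) → solves (C x) τ)
      ≤ℚ PrCond (cartesianProduct (allBits m) rs)
           (λ (y , _) → not (inImage C y)) (λ (y , τ) → not (solves y τ))
  Pr[inverts]≤Pr[∉Im∣fails] {R} {n} {m} n<m C solves solves⇒inImage rs = bound
    where
    xτs : List (Bits n × R)
    xτs = cartesianProduct (allBits n) rs
    yτs : List (Bits m × R)
    yτs = cartesianProduct (allBits m) rs
    inverts : Bits n × R → Bool
    inverts (x , τ) = solves (C x) τ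
    inImage₁ fails : Bits m × R → Bool
    inImage₁ (y , _) = inImage C y
    fails (y , τ) = not (solves y τ)
    S G A F : ℕ
    S = count inverts xτs
    G = count (not ∘ inverts) xτs
    A = count (λ p → not (inImage₁ p) ∧ fails p) yτs
    F = count (λ p → inImage₁ p ∧ fails p) yτs

    F≤G : F ≤ G
    F≤G = count-inImage-∧-≤ C (λ y τ → not (solves y τ)) rs

    notInImage⇒fails : ∀ y τ → not (inImage C y) ∧ not (solves y τ) ≡ not (inImage C y)
    notInImage⇒fails y τ with solves y τ in solved
    ... | false = ∧-identityʳ _
    ... | true rewrite solves⇒inImage solved = refl

    S≤A : S ≤ A
    S≤A = begin
      S                                                   ≤⟨ count≤length inverts xτs ⟩
      length xτs                                          ≡⟨ length-cartesianProduct (allBits n) rs ⟩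
      length (allBits n) * length rs                      ≡⟨ cong (_* length rs) (length-allBits n) ⟩
      2 ^ n * length rs                                   ≤⟨ *-monoˡ-≤ (length rs) (2^n≤count-notInImage C n<m) ⟩
      count (not ∘ inImage C) (allBits m) * length rs     ≡⟨ count-proj₁ (not ∘ inImage C) (allBits m) rs ⟨
      count (not ∘ inImage₁) yτs                          ≡⟨ count-cong yτs (λ (y , τ) → notInImage⇒fails y τ) ⟨
      A                                                   ∎
      where open ≤-Reasoning

    bound : ratio S (length xτs) ≤ℚ ratio A (count fails yτs)
    bound = begin
      ratio S (length xτs)       ≡⟨ cong (ratio S) (count+count-not inverts xτs) ⟨
      ratio S (S + G)            ≤⟨ ratio[s,s+g]≤ratio[a,a+f] S≤A F≤G ⟩
      ratio A (A + F)            ≡⟨ cong (ratio A) (count-split inImage₁ fails yτs) ⟩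
      ratio A (count fails yτs)  ∎
      where open ℚ.≤-Reasoning

open import Defs
open import Data.Bool using (Bool; not)
open import Data.Nat using (ℕ; _<_)
open import Data.Rational using (ℚ; _≤_; 0ℚ)
import Data.Rational as Q
open import Data.List using (cartesianProduct)
open import Data.Maybe using (Maybe)
open import Data.Product using (_,_)
open InversionBound using (Pr[inverts]≤Pr[∉Im∣fails]; succeeds⇒inImage)

lemma4 : (n m r : ℕ) → n < m → (C : Bits n → Bits m)
    → (ε : ℚ) → 0ℚ Q.< ε
    → (M : ℚ → (Bits n → Bits m) → Bits m → Bits r → Maybe (Bits n))
    → Pr (cartesianProduct (allBits n) (allBits r))
         (λ { (x , τ) → succeeds C (M ε C (C x) τ) (C x) })
      ≤ PrCond (cartesianProduct (allBits m) (allBits r))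
         (λ { (y , τ) → not (inImage C y) })
         (λ { (y , τ) → not (succeeds C (M ε C y τ) y) })
lemma4 n m r n<m C ε _ M =
  Pr[inverts]≤Pr[∉Im∣fails] n<m C (λ y τ → succeeds C (M ε C y τ) y)
    (λ {y} {τ} → succeeds⇒inImage C (M ε C y τ)) (allBits r)
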